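{- Let $R$ be a finite group of order $r$ and let $n\ge 71$ be an integer. The number of subsets $S\subseteq R$ for which there exist a non-identity proper normal subgroup $N$ of $R$ with $|N|\ge n$ and an automorphism $f\in\mathrm{Aut}(\Gamma(R,S))$ such that $f$ normalises $N$, $f\notin R$, and $f$ fixes setwise every $N$-orbit, is at most $2^{\,r-\frac{n}{4}+(\log_2 n)^2+(\log_2 r)^2+\log_2 r}$.
   Context: For a finite group $R$ and $S\subseteq R$, the Cayley digraph $\Gamma(R,S)$ has vertex set $R$ and $(g,h)$ is an arc iff $hg^{ -1}\in S$. $R$ and its subgroups are identified with their images under the right regular representation in $\mathrm{Sym}(R)$; thus $R\le\mathrm{Aut}(\Gamma(R,S))$ and the $N$-orbits are the cosets of $N$. -}

module Defs where

open import Data.Nat using (ℕ; _+_; _*_; _^_; _≤_; _<_)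
open import Data.Fin using (Fin)
open import Data.Fin.Subset using (Subset; _∈_; _∉_; ∣_∣)
open import Data.Fin.Permutation using (Permutation′; _⟨$⟩ʳ_; _⟨$⟩ˡ_)
open import Data.Product using (Σ; ∃; _×_)
open import Data.List using (List; length)
open import Data.List.Relation.Unary.All using (All)
open import Data.List.Relation.Unary.Unique.Propositional using (Unique)
open import Relation.Binary.PropositionalEquality using (_≡_)
open import Relation.Nullary using (¬_)
open import Function.Bundles using (_⇔_)

-- A finite group of order r, realised on the carrier Fin r
-- (every finite group of order r is isomorphic to one of these).
record FinGroup (r : ℕ) : Set where
  infixl 7 _∙_
  field
    _∙_     : Fin r → Fin r → Fin r
    e       : Fin r
    _⁻¹     : Fin r → Fin r
    assoc   : ∀ x y z → (x ∙ y) ∙ z ≡ x ∙ (y ∙ z)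
    identityˡ : ∀ x → e ∙ x ≡ x
    identityʳ : ∀ x → x ∙ e ≡ x
    inverseˡ  : ∀ x → (x ⁻¹) ∙ x ≡ e
    inverseʳ  : ∀ x → x ∙ (x ⁻¹) ≡ e

module _ {r : ℕ} (G : FinGroup r) where
  open FinGroup G

  IsSubgroup : Subset r → Set
  IsSubgroup N = (e ∈ N) × (∀ x y → x ∈ N → y ∈ N → (x ∙ y) ∈ N)
                 × (∀ x → x ∈ N → (x ⁻¹) ∈ N)

  IsNormalSubgroup : Subset r → Set
  IsNormalSubgroup N = IsSubgroup N × (∀ g x → x ∈ N → ((g ∙ x) ∙ (g ⁻¹)) ∈ N)

  NonIdentity : Subset r → Set
  NonIdentity N = Σ (Fin r) λ x → (x ∈ N) × ¬ (x ≡ e)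

  Proper : Subset r → Set
  Proper N = Σ (Fin r) λ x → x ∉ N

  -- Arcs of the Cayley digraph Γ(R,S): (g,h) is an arc iff h g⁻¹ ∈ S
  Arc : Subset r → Fin r → Fin r → Set
  Arc S g h = (h ∙ (g ⁻¹)) ∈ S

  IsAut : Subset r → Permutation′ r → Set
  IsAut S f = ∀ g h → Arc S g h ⇔ Arc S (f ⟨$⟩ʳ g) (f ⟨$⟩ʳ h)

  -- f normalises N (N acting by the right regular representation x ↦ x m):
  -- f N f⁻¹ ⊆ N and f⁻¹ N f ⊆ N, i.e. f N f⁻¹ = N.
  Normalises : Permutation′ r → Subset r → Set
  Normalises f N =
    (∀ m → m ∈ N → Σ (Fin r) λ m′ → (m′ ∈ N) ×
        (∀ x → f ⟨$⟩ʳ ((f ⟨$⟩ˡ x) ∙ m) ≡ x ∙ m′))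
    × (∀ m → m ∈ N → Σ (Fin r) λ m′ → (m′ ∈ N) ×
        (∀ x → f ⟨$⟩ˡ ((f ⟨$⟩ʳ x) ∙ m) ≡ x ∙ m′))

  -- f belongs to (the right regular image of) R
  InR : Permutation′ r → Set
  InR f = Σ (Fin r) λ g → ∀ x → f ⟨$⟩ʳ x ≡ x ∙ g

  -- f fixes setwise every N-orbit xN: f(xN) ⊆ xN and xN ⊆ f(xN)
  FixesOrbits : Permutation′ r → Subset r → Set
  FixesOrbits f N =
    (∀ x m → m ∈ N → Σ (Fin r) λ m′ → (m′ ∈ N) × (f ⟨$⟩ʳ (x ∙ m) ≡ x ∙ m′))
    × (∀ x m → m ∈ N → Σ (Fin r) λ m′ → (m′ ∈ N) × (f ⟨$⟩ʳ (x ∙ m′) ≡ x ∙ m))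

  Bad : ℕ → Subset r → Set
  Bad n S = Σ (Subset r) λ N → Σ (Permutation′ r) λ f →
    IsNormalSubgroup N × NonIdentity N × Proper N × (n ≤ ∣ N ∣)
    × IsAut S f × Normalises f N × ¬ InR f × FixesOrbits f N

-- Log2Bound c r n  encodes the real inequality
--   c ≤ 2^( r - n/4 + (log₂ n)^2 + (log₂ r)^2 + log₂ r )
-- (for n, r ≥ 1), via rational upper approximations u = p/q > log₂ n,
-- v = s/t > log₂ r: the inequality holds iff for all such u, v
--   log₂ c ≤ r - n/4 + u² + v² + v,
-- which after multiplying by L = 4q²t² reads
--   c^L · 2^(n q² t²) ≤ 2^(4q²t² r + 4p²t² + 4s²q² + 4stq²).
Log2Bound : ℕ → ℕ → ℕ → Set
Log2Bound c r n = ∀ p q s t → 0 < q → 0 < t → n ^ q < 2 ^ p → r ^ t < 2 ^ s →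
  c ^ (4 * q * q * t * t) * 2 ^ (n * q * q * t * t)
    ≤ 2 ^ (4 * q * q * t * t * r + 4 * p * p * t * t + 4 * s * s * q * q + 4 * s * t * q * q)

-- "the number of S with property P is at most the bound": every duplicate-free
-- list of subsets all satisfying P has length satisfying the bound.
CountBound : {r : ℕ} → (Subset r → Set) → (ℕ → Set) → Set
CountBound {r} P B = (Ss : List (Subset r)) → Unique Ss → All P Ss → B (length Ss)

-- Let S be one of the sets counted, with witnesses N and f. The map h x = f(x) f(e)⁻¹ is
-- injective, fixes e, preserves membership in S (as (e, x) is an arc iff x ∈ S), satisfies
-- h(ym) = h(y) h(m) for m ∈ N (as f normalises N), and is not the identity (as f ∉ R).
-- Adding elements of N one at a time, each doubling the span, yields i + 1 ≈ log₂ n elements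
-- generating some K ≤ N with |K| ≥ n. If h fixes N pointwise it maps x₀K onto h(x₀)K moving
-- every point; otherwise it moves at least |K| points of K ∪ x₀K, where x₀ is the least element
-- outside K. Either way S is closed under a relation fixed by one of at most 2 r^(2i+3)
-- certificates, along which an injective map moves at least n points, and such a relation has at
-- most 2^(r - n/2 + 1/2) closed sets. The resulting bound 2 r^(2i+3) 2^(r - n/2 + 1/2) is at most
-- the stated one because 2 (i + 1) log₂ r ≤ (i + 1)² + (log₂ r)².

module Submission where

open import Level using (0ℓ)
open import Data.Nat using (ℕ; zero; suc; _+_; _*_; _^_; _∸_; _≤_; _<_; z≤n; s≤s; _≤?_; NonZero; >-nonZero)
open import Data.Nat.Properties
  using ( ≤-refl; ≤-trans; ≤-reflexive; ≤-total; ≤-pred; <⇒≤; ≰⇒>; ≤⇒≯; ≤-<-trans; <-cmp; n≤1+n; m≤n⇒m≤1+n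
        ; m≤n⇒m<n∨m≡n; m≤m+n; m<m+n; m∸n+n≡m; m+[n∸m]≡n; +-comm; +-suc; +-identityʳ; *-identityʳ; *-suc
        ; +-mono-≤; +-monoˡ-≤; +-monoʳ-≤; *-mono-≤; *-monoˡ-≤; *-monoʳ-≤; +-cancelˡ-≤; +-cancelʳ-≤; *-cancelˡ-≤
        ; ^-monoˡ-≤; ^-monoʳ-≤; ^-*-assoc; ^-distribˡ-+-*; m^n>0; module ≤-Reasoning )
open import Data.Nat.DivMod using (_/_; _%_; m≡m%n+[m/n]*n; m%n<n; m/n≤m)
open import Data.Nat.Tactic.RingSolver using (solve-∀)
open import Data.Fin using (Fin; Fin′; inject; fromℕ<; toℕ)
import Data.Fin as Fin
open import Data.Fin.Properties
  using (_≟_; toℕ-injective; toℕ-inject; toℕ-fromℕ<; ¬∀⟶∃¬-smallest; ¬∀⟶∃¬; nonZeroIndex)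
import Data.Fin.Properties as Fin
open import Data.Fin.Subset using (Subset; _∈_; _∉_; _⊆_; ∣_∣; inside; outside; ⊤; _-_)
open import Data.Fin.Subset.Properties
  using (_∈?_; drop-∷-⊆; ∈⊤; ∣⊤∣≡n; ∣p∣≤n; ⊆-antisym; p─q⊆p; x∈p∧x≢y⇒x∈p-y; x∈p⇒∣p-x∣<∣p∣)
open import Data.Fin.Permutation using (Permutation′; _⟨$⟩ʳ_; _⟨$⟩ˡ_) renaming (inverseˡ to f⁻¹∘f≗id)
open import Data.Vec using ([]; _∷_)
import Data.Vec as Vec
open import Data.List
  using (List; []; _∷_; [_]; _++_; length; map; filter; allFin; cartesianProduct; cartesianProductWith)
open import Data.List.Properties
  using (length-++; length-++-sucʳ; length-map; length-filter; length-tabulate; map-∘; map-id; filter-++)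
open import Data.List.Relation.Unary.All as All using (All; []; _∷_)
import Data.List.Relation.Unary.All.Properties as All
open import Data.List.Relation.Unary.Any using (here; there)
open import Data.List.Relation.Unary.AllPairs using ([]; _∷_)
open import Data.List.Relation.Unary.Unique.Propositional using (Unique)
open import Data.List.Relation.Unary.Unique.Propositional.Properties using (map⁺; filter⁺; allFin⁺; ++⁺)
open import Data.List.Membership.Propositional using () renaming (_∈_ to _∈ₗ_; _∉_ to _∉ₗ_)
open import Data.List.Membership.Propositional.Properties
  using ( ∈-∃++; ∈-++⁻; ∈-++⁺ˡ; ∈-++⁺ʳ; ∈-map⁺; ∈-map⁻; ∈-filter⁺; ∈-filter⁻; ∈-allFin
        ; ∈-cartesianProductWith⁺; ∈-cartesianProduct⁺ )
open import Data.List.Relation.Binary.Subset.Propositional using () renaming (_⊆_ to _⊆ₗ_)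
open import Data.Product using (∃; ∃₂; _×_; _,_; proj₁; proj₂)
open import Data.Sum using (_⊎_; inj₁; inj₂)
open import Data.Empty using (⊥-elim)
open import Function using (id; _∘_; _⇔_; mk⇔; Equivalence)
open import Function.Definitions using (Injective)
open import Function.Properties.Equivalence using (⇔-isEquivalence)
open import Algebra.Bundles using (Group)
import Algebra.Properties.Group as GroupProperties
open import Effect.Monad using (RawMonad)
open import Relation.Nullary using (¬_; ¬?; yes; no; contradiction)
open import Relation.Nullary.Negation using (¬¬-Monad)
open import Relation.Nullary.Decidable using (¬¬-excluded-middle; _×-dec_; decidable-stable)
open import Relation.Unary using (Decidable)
open import Relation.Unary.Properties using (∁?)
open import Relation.Binary.Structures using (IsEquivalence)
open import Relation.Binary.Definitions using (tri<; tri≈; tri>)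
open import Relation.Binary.PropositionalEquality
  using (_≡_; _≢_; refl; sym; trans; cong; cong₂; subst; subst₂; isEquivalence; module ≡-Reasoning)
open import Defs

open RawMonad (¬¬-Monad {0ℓ}) using (pure; _>>=_)

private variable
  A B : Set
  xs ys : List A
  r : ℕ
  x z : Fin r
  p q : Subset r

-- Counting duplicate-free lists

unique-⊆⇒length≤ : Unique xs → xs ⊆ₗ ys → length xs ≤ length ys
unique-⊆⇒length≤ {xs = []} _ _ = z≤n
unique-⊆⇒length≤ {xs = x ∷ xs} (x∉xs ∷ xs!) xs⊆ys with ∈-∃++ (xs⊆ys (here refl))
... | ys₁ , ys₂ , refl = subst (suc (length xs) ≤_) (sym (length-++-sucʳ ys₁ x ys₂))
  (s≤s (unique-⊆⇒length≤ xs! λ z∈xs → skip (xs⊆ys (there z∈xs)) (All.lookup x∉xs z∈xs ∘ sym)))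
  where
  skip : ∀ {z} → z ∈ₗ ys₁ ++ x ∷ ys₂ → z ≢ x → z ∈ₗ ys₁ ++ ys₂
  skip z∈ z≢x with ∈-++⁻ ys₁ z∈
  ... | inj₁ z∈ys₁ = ∈-++⁺ˡ z∈ys₁
  ... | inj₂ (here z≡x) = ⊥-elim (z≢x z≡x)
  ... | inj₂ (there z∈ys₂) = ∈-++⁺ʳ ys₁ z∈ys₂

all-equal⇒length≤1 : Unique xs → (∀ {x y} → x ∈ₗ xs → y ∈ₗ xs → x ≡ y) → length xs ≤ 1
all-equal⇒length≤1 [] _ = z≤n
all-equal⇒length≤1 ([] ∷ []) _ = s≤s z≤n
all-equal⇒length≤1 ((x≢y ∷ _) ∷ _) all-equal = ⊥-elim (x≢y (all-equal (here refl) (there (here refl))))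

Unique-map⁺ : {P : A → Set} {f : A → B} →
  (∀ {x y} → P x → P y → f x ≡ f y → x ≡ y) → All P xs → Unique xs → Unique (map f xs)
Unique-map⁺ f-inj [] [] = []
Unique-map⁺ f-inj (px ∷ pxs) (x∉xs ∷ xs!) =
  All.map⁺ (All.zipWith (λ (py , x≢y) fx≡fy → x≢y (f-inj px py fx≡fy)) (pxs , x∉xs))
  ∷ Unique-map⁺ f-inj pxs xs!

record Partition (P Q : A → Set) (xs : List A) : Set where
  field
    left right : List A
    left⊆ : left ⊆ₗ xs
    right⊆ : right ⊆ₗ xs
    left-unique : Unique left
    right-unique : Unique right
    left-all : All P left
    right-all : All Q right
    length-split : length xs ≡ length left + length right

partition-⊎ : {P Q : A → Set} → Unique xs → All (λ x → P x ⊎ Q x) xs → Partition P Q xs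
partition-⊎ [] [] = record
  { left = [] ; right = [] ; left⊆ = λ () ; right⊆ = λ () ; left-unique = [] ; right-unique = []
  ; left-all = [] ; right-all = [] ; length-split = refl }
partition-⊎ {xs = x ∷ xs} (x∉xs ∷ xs!) (pq ∷ pqs) = add pq (partition-⊎ xs! pqs)
  where
  add : _ ⊎ _ → Partition _ _ xs → Partition _ _ (x ∷ xs)
  add (inj₁ px) p = record
    { left = x ∷ left ; right = right
    ; left⊆ = λ { (here refl) → here refl ; (there y∈) → there (left⊆ y∈) } ; right⊆ = there ∘ right⊆
    ; left-unique = All.anti-mono left⊆ x∉xs ∷ left-unique ; right-unique = right-unique
    ; left-all = px ∷ left-all ; right-all = right-all ; length-split = cong suc length-split }
    where open Partition p
  add (inj₂ qx) p = record
    { left = left ; right = x ∷ right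
    ; left⊆ = there ∘ left⊆ ; right⊆ = λ { (here refl) → here refl ; (there y∈) → there (right⊆ y∈) }
    ; left-unique = left-unique ; right-unique = All.anti-mono right⊆ x∉xs ∷ right-unique
    ; left-all = left-all ; right-all = qx ∷ right-all
    ; length-split = trans (cong suc length-split) (sym (+-suc (length left) (length right))) }
    where open Partition p

union-bound : ∀ {r} {D : Set} (Q : D → Subset r → Set) {B : ℕ} → (∀ d → CountBound (Q d) (_≤ B)) →
  ∀ Ds → CountBound (λ S → ∃ λ d → d ∈ₗ Ds × Q d S) (_≤ length Ds * B)
union-bound Q bound [] [] _ _ = z≤n
union-bound Q bound [] (S ∷ Ss) _ ((_ , () , _) ∷ _)
union-bound Q {B} bound (d ∷ Ds) Ss Ss! witnesses = begin
  length Ss                  ≡⟨ length-split ⟩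
  length left + length right ≤⟨ +-mono-≤ (bound d left left-unique left-all)
                                        (union-bound Q bound Ds right right-unique right-all) ⟩
  B + length Ds * B          ∎
  where
  open ≤-Reasoning
  first-or-rest : ∀ {S} → (∃ λ d′ → d′ ∈ₗ d ∷ Ds × Q d′ S) → Q d S ⊎ (∃ λ d′ → d′ ∈ₗ Ds × Q d′ S)
  first-or-rest (_ , here refl , q) = inj₁ q
  first-or-rest (d′ , there d′∈ , q) = inj₂ (d′ , d′∈ , q)
  open Partition (partition-⊎ Ss! (All.map first-or-rest witnesses))

subsetsOf : ∀ {r} → Subset r → List (Subset r)
subsetsOf [] = [ [] ]
subsetsOf (outside ∷ U) = map (outside ∷_) (subsetsOf U)
subsetsOf (inside ∷ U) = map (outside ∷_) (subsetsOf U) ++ map (inside ∷_) (subsetsOf U)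

length-subsetsOf : ∀ {r} (U : Subset r) → length (subsetsOf U) ≡ 2 ^ ∣ U ∣
length-subsetsOf [] = refl
length-subsetsOf (outside ∷ U) = trans (length-map _ (subsetsOf U)) (length-subsetsOf U)
length-subsetsOf (inside ∷ U) = begin
  length (map (outside ∷_) (subsetsOf U) ++ map (inside ∷_) (subsetsOf U))
    ≡⟨ length-++ (map (outside ∷_) (subsetsOf U)) ⟩
  length (map (outside ∷_) (subsetsOf U)) + length (map (inside ∷_) (subsetsOf U))
    ≡⟨ cong₂ _+_ (length-map _ (subsetsOf U)) (length-map _ (subsetsOf U)) ⟩
  length (subsetsOf U) + length (subsetsOf U)
    ≡⟨ cong (λ k → k + k) (length-subsetsOf U) ⟩
  2 ^ ∣ U ∣ + 2 ^ ∣ U ∣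
    ≡⟨ cong (2 ^ ∣ U ∣ +_) (sym (+-identityʳ (2 ^ ∣ U ∣))) ⟩
  2 * 2 ^ ∣ U ∣ ∎
  where open ≡-Reasoning

∈-subsetsOf : ∀ {r} {S U : Subset r} → S ⊆ U → S ∈ₗ subsetsOf U
∈-subsetsOf {S = []} {[]} _ = here refl
∈-subsetsOf {S = outside ∷ S} {outside ∷ U} S⊆U = ∈-map⁺ _ (∈-subsetsOf (drop-∷-⊆ S⊆U))
∈-subsetsOf {S = outside ∷ S} {inside ∷ U} S⊆U = ∈-++⁺ˡ (∈-map⁺ _ (∈-subsetsOf (drop-∷-⊆ S⊆U)))
∈-subsetsOf {S = inside ∷ S} {inside ∷ U} S⊆U = ∈-++⁺ʳ _ (∈-map⁺ _ (∈-subsetsOf (drop-∷-⊆ S⊆U)))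
∈-subsetsOf {S = inside ∷ S} {outside ∷ U} S⊆U with S⊆U Vec.here
... | ()

count-subsets : ∀ {r} (U : Subset r) → CountBound (_⊆ U) (_≤ 2 ^ ∣ U ∣)
count-subsets U Ss Ss! Ss⊆U = subst (length Ss ≤_) (length-subsetsOf U)
  (unique-⊆⇒length≤ Ss! (λ S∈Ss → ∈-subsetsOf (All.lookup Ss⊆U S∈Ss)))

injection⇒length≤ : {f : A → B} → Injective _≡_ _≡_ f → Unique xs → (∀ {x} → x ∈ₗ xs → f x ∈ₗ ys) →
  length xs ≤ length ys
injection⇒length≤ {xs = xs} {ys} {f} f-injective xs! f[xs]⊆ys =
  subst (_≤ length ys) (length-map f xs) (unique-⊆⇒length≤ (map⁺ f-injective xs!) image⊆ys)
  where
  image⊆ys : map f xs ⊆ₗ ys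
  image⊆ys y∈ with ∈-map⁻ f y∈
  ... | x , x∈xs , refl = f[xs]⊆ys x∈xs

module _ {r : ℕ} where

  elementsOf : {P : Fin r → Set} → Decidable P → List (Fin r)
  elementsOf P? = filter P? (allFin r)

  module _ {P : Fin r → Set} (P? : Decidable P) where

    elementsOf-unique : Unique (elementsOf P?)
    elementsOf-unique = filter⁺ P? (allFin⁺ r)

    ∈-elementsOf⁺ : ∀ {x} → P x → x ∈ₗ elementsOf P?
    ∈-elementsOf⁺ {x} = ∈-filter⁺ P? (∈-allFin x)

    ∈-elementsOf⁻ : ∀ {x} → x ∈ₗ elementsOf P? → P x
    ∈-elementsOf⁻ = proj₂ ∘ ∈-filter⁻ P? {xs = allFin r}

members : ∀ {r} → Subset r → List (Fin r)
members [] = []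
members (outside ∷ p) = map Fin.suc (members p)
members (inside ∷ p) = Fin.zero ∷ map Fin.suc (members p)

members-unique : ∀ {r} (p : Subset r) → Unique (members p)
members-unique [] = []
members-unique (outside ∷ p) = map⁺ Fin.suc-injective (members-unique p)
members-unique (inside ∷ p) =
  All.map⁺ (All.tabulate λ _ ()) ∷ map⁺ Fin.suc-injective (members-unique p)

∈-members : ∀ {r} {p : Subset r} {x} → x ∈ₗ members p → x ∈ p
∈-members {p = inside ∷ p} (here refl) = Vec.here
∈-members {p = inside ∷ p} (there x∈) with ∈-map⁻ Fin.suc x∈
... | _ , y∈ , refl = Vec.there (∈-members y∈)
∈-members {p = outside ∷ p} x∈ with ∈-map⁻ Fin.suc x∈
... | _ , y∈ , refl = Vec.there (∈-members y∈)

length-members : ∀ {r} (p : Subset r) → length (members p) ≡ ∣ p ∣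
length-members [] = refl
length-members (outside ∷ p) = trans (length-map Fin.suc (members p)) (length-members p)
length-members (inside ∷ p) = cong suc (trans (length-map Fin.suc (members p)) (length-members p))

∣p∣≤length : ∀ {r} {p : Subset r} {xs} → Unique xs → (∀ {x} → x ∈ p → x ∈ₗ xs) → ∣ p ∣ ≤ length xs
∣p∣≤length {p = p} xs! p⊆xs = subst (_≤ _) (length-members p)
  (unique-⊆⇒length≤ (members-unique p) (p⊆xs ∘ ∈-members))

¬¬-decidable : ∀ {r} (P : Fin r → Set) → ¬ ¬ Decidable P
¬¬-decidable {zero} P = pure λ ()
¬¬-decidable {suc r} P = do
  P0? ← ¬¬-excluded-middle
  P-suc? ← ¬¬-decidable (P ∘ Fin.suc)
  pure λ { Fin.zero → P0? ; (Fin.suc x) → P-suc? x }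

length-cartesianProductWith : ∀ {C : Set} (f : A → B → C) xs (ys : List B) →
  length (cartesianProductWith f xs ys) ≡ length xs * length ys
length-cartesianProductWith f [] ys = refl
length-cartesianProductWith f (x ∷ xs) ys = begin
  length (map (f x) ys ++ cartesianProductWith f xs ys)
    ≡⟨ length-++ (map (f x) ys) ⟩
  length (map (f x) ys) + length (cartesianProductWith f xs ys)
    ≡⟨ cong₂ _+_ (length-map (f x) ys) (length-cartesianProductWith f xs ys) ⟩
  length ys + length xs * length ys ∎
  where open ≡-Reasoning

tuples : List A → ℕ → List (List A)
tuples xs zero = [ [] ]
tuples xs (suc j) = cartesianProductWith _∷_ xs (tuples xs j)

length-tuples : ∀ (xs : List A) j → length (tuples xs j) ≡ length xs ^ j
length-tuples xs zero = refl
length-tuples xs (suc j) =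
  trans (length-cartesianProductWith _∷_ xs (tuples xs j)) (cong (length xs *_) (length-tuples xs j))

∈-tuples : All (_∈ₗ xs) ys → ys ∈ₗ tuples xs (length ys)
∈-tuples [] = here refl
∈-tuples (y∈xs ∷ ys⊆xs) = ∈-cartesianProductWith⁺ _∷_ y∈xs (∈-tuples ys⊆xs)

length-filter-∁ : {P : A → Set} (P? : Decidable P) (xs : List A) →
  length xs ≡ length (filter P? xs) + length (filter (∁? P?) xs)
length-filter-∁ P? [] = refl
length-filter-∁ P? (x ∷ xs) with P? x
... | yes _ = cong suc (length-filter-∁ P? xs)
... | no _ = trans (cong suc (length-filter-∁ P? xs)) (sym (+-suc _ _))

-- Sets closed under a partial injection

x∉p-x : ∀ (p : Subset r) x → x ∉ p - x
x∉p-x (_ ∷ p) Fin.zero ()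
x∉p-x (_ ∷ p) (Fin.suc x) (Vec.there x∈p-x) = x∉p-x p x x∈p-x

∈-remove : z ≢ x → z ∈ p - x ⇔ z ∈ p
∈-remove {p = p} z≢x = mk⇔ (p─q⊆p p _) (λ z∈p → x∈p∧x≢y⇒x∈p-y z∈p z≢x)

remove-injective : ∀ x → p - x ≡ q - x → x ∈ p ⇔ x ∈ q → p ≡ q
remove-injective x p-x≡q-x x∈p⇔x∈q =
  ⊆-antisym (⊆-from p-x≡q-x (Equivalence.to x∈p⇔x∈q)) (⊆-from (sym p-x≡q-x) (Equivalence.from x∈p⇔x∈q))
  where
  ⊆-from : ∀ {p q} → p - x ≡ q - x → (x ∈ p → x ∈ q) → p ⊆ q
  ⊆-from {p} {q} eq x∈p⇒x∈q {z} z∈p with z ≟ x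
  ... | yes refl = x∈p⇒x∈q z∈p
  ... | no z≢x = Equivalence.to (∈-remove z≢x) (subst (z ∈_) eq (Equivalence.from (∈-remove z≢x) z∈p))

budget-after-removal : ∀ {b k K l L} → suc k ≤ K → 2 * K ≤ 2 * b + suc L → L ≤ suc l → 2 * k ≤ 2 * b + l
budget-after-removal {b} {k} {K} {l} {L} k<K K-budget L≤1+l = +-cancelˡ-≤ 2 (2 * k) (2 * b + l) (begin
  2 + 2 * k       ≡⟨ *-suc 2 k ⟨
  2 * suc k       ≤⟨ *-monoʳ-≤ 2 k<K ⟩
  2 * K           ≤⟨ K-budget ⟩
  2 * b + suc L   ≤⟨ +-monoʳ-≤ (2 * b) (s≤s L≤1+l) ⟩
  2 * b + (2 + l) ≡⟨ +-comm (2 * b) (2 + l) ⟩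
  2 + l + 2 * b   ≡⟨ cong (2 +_) (+-comm l (2 * b)) ⟩
  2 + (2 * b + l) ∎)
  where open ≤-Reasoning

Respects : (Fin r → Fin r) → List (Fin r) → Subset r → Set
Respects π X S = All (λ x → x ∈ S ⇔ π x ∈ S) X

private
  module ⇔ {ℓ} = IsEquivalence (⇔-isEquivalence {ℓ})
  infixr 5 _⟨⇔⟩_
  _⟨⇔⟩_ : ∀ {A B C : Set} → A ⇔ B → B ⇔ C → A ⇔ C
  _⟨⇔⟩_ = ⇔.trans

module _ {π : Fin r → Fin r} (π-injective : Injective _≡_ _≡_ π) where

  avoiding : Fin r → List (Fin r) → List (Fin r)
  avoiding x = filter (∁? (λ z → π z ≟ x))

  length-avoiding : ∀ x {X} → Unique X → length X ≤ suc (length (avoiding x X))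
  length-avoiding x {X} X! = begin
    length X                                          ≡⟨ length-filter-∁ (λ z → π z ≟ x) X ⟩
    length (filter (λ z → π z ≟ x) X) + length (avoiding x X) ≤⟨ +-mono-≤ at-most-one ≤-refl ⟩
    suc (length (avoiding x X))                       ∎
    where
    open ≤-Reasoning
    at-most-one : length (filter (λ z → π z ≟ x) X) ≤ 1
    at-most-one = all-equal⇒length≤1 (filter⁺ (λ z → π z ≟ x) X!) λ y∈ z∈ →
      π-injective (trans (proj₂ (∈-filter⁻ (λ z → π z ≟ x) {xs = X} y∈))
                         (sym (proj₂ (∈-filter⁻ (λ z → π z ≟ x) {xs = X} z∈))))

  -- x ∈ S is determined by π x ∈ S, so S ↦ S - x loses no information
  remove-forced : ∀ {U x X} {m : ℕ} → All (x ≢_) X → π x ≢ x →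
    CountBound (λ S → S ⊆ U - x × Respects π (avoiding x X) S) (_≤ m) →
    CountBound (λ S → S ⊆ U × Respects π (x ∷ X) S) (_≤ m)
  remove-forced {U} {x} {X} x∉X πx≢x count Ss Ss! ok =
    subst (_≤ _) (length-map (_- x) Ss) (count (map (_- x) Ss) Ss-x! (All.map⁺ (All.map reduce ok)))
    where
    forced : ∀ {S} → x ∈ S ⇔ π x ∈ S → x ∈ S ⇔ π x ∈ S - x
    forced x∈S⇔πx∈S = x∈S⇔πx∈S ⟨⇔⟩ ⇔.sym (∈-remove πx≢x)

    Ss-x! : Unique (map (_- x) Ss)
    Ss-x! = Unique-map⁺ (λ { (_ , x∈S⇔πx∈S ∷ _) (_ , x∈T⇔πx∈T ∷ _) S-x≡T-x → remove-injective x S-x≡T-x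
      (forced x∈S⇔πx∈S ⟨⇔⟩ subst (λ V → π x ∈ _ ⇔ π x ∈ V) S-x≡T-x ⇔.refl ⟨⇔⟩ ⇔.sym (forced x∈T⇔πx∈T)) })
      ok Ss!

    reduce : ∀ {S} → S ⊆ U × Respects π (x ∷ X) S → S - x ⊆ U - x × Respects π (avoiding x X) (S - x)
    reduce {S} (S⊆U , _ ∷ S-respects) = S-x⊆U-x , S-x-respects
      where
      S-x⊆U-x : S - x ⊆ U - x
      S-x⊆U-x {z} z∈S-x = Equivalence.from (∈-remove z≢x) (S⊆U (Equivalence.to (∈-remove z≢x) z∈S-x))
        where
        z≢x : z ≢ x
        z≢x refl = x∉p-x _ x z∈S-x
      S-x-respects : Respects π (avoiding x X) (S - x)
      S-x-respects = All.tabulate λ z∈ → let (z∈X , πz≢x) = ∈-filter⁻ (λ z → ¬? (π z ≟ x)) {xs = X} z∈ in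
        ∈-remove (All.lookup x∉X z∈X ∘ sym) ⟨⇔⟩ All.lookup S-respects z∈X ⟨⇔⟩ ⇔.sym (∈-remove πz≢x)

  -- Removing x from U costs one point of U and at most two constraints: that of x and that of
  -- its π-preimage.
  count-respecting : ∀ {U X} b → Unique X → All (_∈ U) X → All (λ x → π x ≢ x) X →
    2 * ∣ U ∣ ≤ 2 * b + length X → CountBound (λ S → S ⊆ U × Respects π X S) (_≤ 2 ^ b)
  count-respecting b = go _ ≤-refl
    where
    go : ∀ k {U X} → length X ≤ k → Unique X → All (_∈ U) X → All (λ x → π x ≢ x) X →
      2 * ∣ U ∣ ≤ 2 * b + length X → CountBound (λ S → S ⊆ U × Respects π X S) (_≤ 2 ^ b)
    go _ {U} {[]} _ _ _ _ budget Ss Ss! ok =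
      ≤-trans (count-subsets U Ss Ss! (All.map proj₁ ok))
              (^-monoʳ-≤ 2 {∣ U ∣} {b} (*-cancelˡ-≤ 2 (subst (2 * ∣ U ∣ ≤_) (+-identityʳ (2 * b)) budget)))
    go (suc k) {U} {x ∷ X} (s≤s len) (x∉X ∷ X!) (x∈U ∷ X⊆U) (πx≢x ∷ moves) budget =
      remove-forced {U} {x} {X} x∉X πx≢x (go k {U - x} {avoiding x X}
        (≤-trans (length-filter avoids? X) len)
        (filter⁺ avoids? X!)
        (All.filter⁺ avoids? (All.zipWith (λ (z∈U , x≢z) → Equivalence.from (∈-remove (x≢z ∘ sym)) z∈U) (X⊆U , x∉X)))
        (All.filter⁺ avoids? moves)
        (budget-after-removal {b} (x∈p⇒∣p-x∣<∣p∣ x∈U) budget (length-avoiding x X!)))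
      where
      avoids? : Decidable (λ z → ¬ π z ≡ x)
      avoids? = ∁? (λ z → π z ≟ x)

Closed : (Fin r → Fin r → Set) → Subset r → Set
Closed C S = ∀ {u v} → C u v → u ∈ S ⇔ v ∈ S

record Displacement (n : ℕ) (C : Fin r → Fin r → Set) : Set where
  field
    shift : Fin r → Fin r
    shift-injective : Injective _≡_ _≡_ shift
    support : List (Fin r)
    support-unique : Unique support
    support-large : n ≤ length support
    shift-moves : All (λ x → shift x ≢ x) support
    shift-along : All (λ x → C x (shift x)) support

count-closed : ∀ {n} b {C : Fin r → Fin r → Set} → 2 * r ≤ 2 * b + n →
  CountBound (λ S → Closed C S × Displacement n C) (_≤ 2 ^ b)
count-closed b budget [] _ _ = z≤n
count-closed {r} b {C} budget Ss@(_ ∷ _) Ss! ok@((_ , D) ∷ _) =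
  count-respecting shift-injective {⊤} {support} b support-unique (All.tabulate λ _ → ∈⊤) shift-moves
    (subst (λ m → 2 * m ≤ 2 * b + length support) (sym (∣⊤∣≡n r))
      (≤-trans budget (+-monoʳ-≤ (2 * b) support-large)))
    Ss Ss! (All.map (λ (closed , _) → (λ {x} _ → ∈⊤ {x = x}) , All.map closed shift-along) ok)
  where open Displacement D

-- Generated subgroups

asGroup : ∀ {r} → FinGroup r → Group 0ℓ 0ℓ
asGroup {r} R = record
  { Carrier = Fin r ; _≈_ = _≡_ ; _∙_ = _∙_ ; ε = e ; _⁻¹ = _⁻¹
  ; isGroup = record
    { isMonoid = record
      { isSemigroup = record
        { isMagma = record { isEquivalence = isEquivalence ; ∙-cong = cong₂ _∙_ }
        ; assoc = assoc }
      ; identity = identityˡ , identityʳ }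
    ; inverse = inverseˡ , inverseʳ
    ; ⁻¹-cong = cong _⁻¹ } }
  where open FinGroup R

module Generation {A : Set} (_∙_ : A → A → A) (ε : A) (_⁻¹ : A → A) where

  data ⟨_⟩ (L : List A) : A → Set where
    generator : ∀ {x} → x ∈ₗ L → ⟨ L ⟩ x
    ε∈ : ⟨ L ⟩ ε
    ∙∈ : ∀ {x y} → ⟨ L ⟩ x → ⟨ L ⟩ y → ⟨ L ⟩ (x ∙ y)
    ⁻¹∈ : ∀ {x} → ⟨ L ⟩ x → ⟨ L ⟩ (x ⁻¹)

  SubgroupClosed : (A → Set) → Set
  SubgroupClosed Q = Q ε × (∀ x y → Q x → Q y → Q (x ∙ y)) × (∀ x → Q x → Q (x ⁻¹))

  ⟨⟩-least : ∀ {Q L} → SubgroupClosed Q → All Q L → ∀ {x} → ⟨ L ⟩ x → Q x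
  ⟨⟩-least _ Q-L (generator x∈L) = All.lookup Q-L x∈L
  ⟨⟩-least (Qε , _ , _) _ ε∈ = Qε
  ⟨⟩-least Q-closed@(_ , Q∙ , _) Q-L (∙∈ x∈ y∈) = Q∙ _ _ (⟨⟩-least Q-closed Q-L x∈) (⟨⟩-least Q-closed Q-L y∈)
  ⟨⟩-least Q-closed@(_ , _ , Q⁻¹) Q-L (⁻¹∈ x∈) = Q⁻¹ _ (⟨⟩-least Q-closed Q-L x∈)

  ⟨⟩-mono : ∀ {L} g {x} → ⟨ L ⟩ x → ⟨ g ∷ L ⟩ x
  ⟨⟩-mono g = ⟨⟩-least (ε∈ , (λ _ _ → ∙∈) , (λ _ → ⁻¹∈)) (All.tabulate (generator ∘ there))

module Subgroups {r : ℕ} (R : FinGroup r) where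
  open FinGroup R
  open GroupProperties (asGroup R)
    using (∙-cancelˡ; \\-leftDividesʳ; //-rightDividesʳ; ⁻¹-anti-homo-∙)
  open Generation _∙_ e _⁻¹ public

  ⟨⟩-divide : ∀ {L g k} → ⟨ L ⟩ k → ⟨ L ⟩ (g ∙ k) → ⟨ L ⟩ g
  ⟨⟩-divide {L} {g} {k} k∈ gk∈ = subst ⟨ L ⟩ (//-rightDividesʳ k g) (∙∈ gk∈ (⁻¹∈ k∈))

  coset-quotient : ∀ w a b → (w ∙ a) ⁻¹ ∙ (w ∙ b) ≡ a ⁻¹ ∙ b
  coset-quotient w a b = begin
    (w ∙ a) ⁻¹ ∙ (w ∙ b)        ≡⟨ cong (_∙ (w ∙ b)) (⁻¹-anti-homo-∙ w a) ⟩
    (a ⁻¹ ∙ w ⁻¹) ∙ (w ∙ b)     ≡⟨ assoc _ _ _ ⟩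
    a ⁻¹ ∙ (w ⁻¹ ∙ (w ∙ b))     ≡⟨ cong (a ⁻¹ ∙_) (\\-leftDividesʳ w b) ⟩
    a ⁻¹ ∙ b                    ∎
    where open ≡-Reasoning

  coset-doubling : ∀ g {F K : List (Fin r)} → Unique F → F ⊆ₗ K →
    (∀ {k} → k ∈ₗ F → g ∙ k ∈ₗ K) → (∀ {k} → k ∈ₗ F → g ∙ k ∉ₗ F) → 2 * length F ≤ length K
  coset-doubling g {F} {K} F! F⊆K gF⊆K gF∩F≡∅ = begin
    2 * length F                        ≡⟨ cong (length F +_) (+-identityʳ (length F)) ⟩
    length F + length F                 ≡⟨ cong (length F +_) (sym (length-map (g ∙_) F)) ⟩
    length F + length (map (g ∙_) F)    ≡⟨ sym (length-++ F) ⟩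
    length (F ++ map (g ∙_) F)          ≤⟨ unique-⊆⇒length≤ (++⁺ F! (map⁺ (∙-cancelˡ g _ _) F!) disjoint) F∪gF⊆K ⟩
    length K                            ∎
    where
    open ≤-Reasoning
    disjoint : ∀ {v} → ¬ (v ∈ₗ F × v ∈ₗ map (g ∙_) F)
    disjoint (v∈F , v∈gF) with ∈-map⁻ (g ∙_) v∈gF
    ... | k , k∈F , refl = gF∩F≡∅ k∈F v∈F
    F∪gF⊆K : F ++ map (g ∙_) F ⊆ₗ K
    F∪gF⊆K v∈ with ∈-++⁻ F v∈
    ... | inj₁ v∈F = F⊆K v∈F
    ... | inj₂ v∈gF with ∈-map⁻ (g ∙_) v∈gF
    ...   | k , k∈F , refl = gF⊆K k∈F

  module _ {N : Subset r} (N-subgroup : IsSubgroup R N) where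

    record LargeSpan (i : ℕ) (m : Fin r) : Set where
      field
        gens : List (Fin r)
        gens-length : length gens ≡ suc i
        gens⊆N : All (_∈ N) gens
        m∈span : ⟨ gens ⟩ m
        ⟨gens⟩? : Decidable ⟨ gens ⟩
        large : 2 ^ suc i ≤ length (elementsOf ⟨gens⟩?) ⊎ (∀ {x} → x ∈ N → ⟨ gens ⟩ x)

    -- Each generator added from N outside the current span at least doubles it.
    large-span : ∀ {m} → m ∈ N → m ≢ e → ∀ i → ¬ ¬ LargeSpan i m
    large-span {m} m∈N m≢e zero = do
      K? ← ¬¬-decidable ⟨ m ∷ [] ⟩
      pure record
        { gens = m ∷ [] ; gens-length = refl ; gens⊆N = m∈N ∷ [] ; m∈span = generator (here refl)
        ; ⟨gens⟩? = K?
        ; large = inj₁ (unique-⊆⇒length≤ (((m≢e ∘ sym) ∷ []) ∷ [] ∷ []) λ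
            { (here refl) → ∈-elementsOf⁺ K? ε∈ ; (there (here refl)) → ∈-elementsOf⁺ K? (generator (here refl)) }) }
    large-span {m} m∈N m≢e (suc i) = large-span m∈N m≢e i >>= extend
      where
      extend : LargeSpan i m → ¬ ¬ LargeSpan (suc i) m
      extend s with Fin.any? (λ g → g ∈? N ×-dec ¬? (⟨gens⟩? g))
        where open LargeSpan s
      ... | yes (g , g∈N , g∉K) = do
        K′? ← ¬¬-decidable ⟨ g ∷ gens ⟩
        pure record
          { gens = g ∷ gens ; gens-length = cong suc gens-length ; gens⊆N = g∈N ∷ gens⊆N
          ; m∈span = ⟨⟩-mono g m∈span ; ⟨gens⟩? = K′?
          ; large = inj₁ (≤-trans (*-monoʳ-≤ 2 K-large) (coset-doubling g (elementsOf-unique ⟨gens⟩?)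
              (∈-elementsOf⁺ K′? ∘ ⟨⟩-mono g ∘ ∈-elementsOf⁻ ⟨gens⟩?)
              (λ k∈ → ∈-elementsOf⁺ K′? (∙∈ (generator (here refl)) (⟨⟩-mono g (∈-elementsOf⁻ ⟨gens⟩? k∈))))
              (λ k∈ gk∈ → g∉K (⟨⟩-divide (∈-elementsOf⁻ ⟨gens⟩? k∈) (∈-elementsOf⁻ ⟨gens⟩? gk∈))))) }
        where
        open LargeSpan s
        K-large : 2 ^ suc i ≤ length (elementsOf ⟨gens⟩?)
        K-large with large
        ... | inj₁ K-large = K-large
        ... | inj₂ N⊆K = ⊥-elim (g∉K (N⊆K g∈N))
      ... | no N⊆K = do
        K′? ← ¬¬-decidable ⟨ m ∷ gens ⟩
        pure record
          { gens = m ∷ gens ; gens-length = cong suc gens-length ; gens⊆N = m∈N ∷ gens⊆N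
          ; m∈span = ⟨⟩-mono m m∈span ; ⟨gens⟩? = K′?
          ; large = inj₂ λ {x} x∈N → ⟨⟩-mono m (decidable-stable (⟨gens⟩? x) λ x∉K → N⊆K (x , x∈N , x∉K)) }
        where open LargeSpan s

    LargeSpan-size : ∀ {n i m} → n ≤ 2 ^ suc i → n ≤ ∣ N ∣ → (s : LargeSpan i m) →
      n ≤ length (elementsOf (LargeSpan.⟨gens⟩? s))
    LargeSpan-size n≤2^[1+i] n≤∣N∣ s with LargeSpan.large s
    ... | inj₁ 2^[1+i]≤∣K∣ = ≤-trans n≤2^[1+i] 2^[1+i]≤∣K∣
    ... | inj₂ N⊆K = ≤-trans n≤∣N∣ (∣p∣≤length (elementsOf-unique ⟨gens⟩?) (∈-elementsOf⁺ ⟨gens⟩? ∘ N⊆K))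
      where open LargeSpan s

-- The automorphism translated to fix e

module Twist {r : ℕ} (R : FinGroup r) {S N : Subset r} {f : Permutation′ r}
             (f-aut : IsAut R S f) (f-normalises : Normalises R f N) where
  open FinGroup R
  open GroupProperties (asGroup R)
    using (∙-cancelˡ; ∙-cancelʳ; ε⁻¹≈ε; \\-leftDividesˡ; \\-leftDividesʳ; //-rightDividesˡ; inverseˡ-unique)
  open ≡-Reasoning

  a : Fin r
  a = f ⟨$⟩ʳ e

  h : Fin r → Fin r
  h x = (f ⟨$⟩ʳ x) ∙ a ⁻¹

  h-injective : Injective _≡_ _≡_ h
  h-injective {x} {y} hx≡hy = begin
    x                     ≡⟨ f⁻¹∘f≗id f ⟨
    f ⟨$⟩ˡ (f ⟨$⟩ʳ x)     ≡⟨ cong (f ⟨$⟩ˡ_) (∙-cancelʳ (a ⁻¹) _ _ hx≡hy) ⟩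
    f ⟨$⟩ˡ (f ⟨$⟩ʳ y)     ≡⟨ f⁻¹∘f≗id f ⟩
    y                     ∎

  h-e : h e ≡ e
  h-e = inverseʳ a

  ∈⇔h∈ : ∀ x → x ∈ S ⇔ h x ∈ S
  ∈⇔h∈ x = subst (λ y → y ∈ S ⇔ h x ∈ S) x∙e⁻¹≡x (f-aut e x)
    where
    x∙e⁻¹≡x : x ∙ e ⁻¹ ≡ x
    x∙e⁻¹≡x = trans (cong (x ∙_) ε⁻¹≈ε) (identityʳ x)

  f-translates : ∀ {m} → m ∈ N → ∃ λ m′ → ∀ y → f ⟨$⟩ʳ (y ∙ m) ≡ (f ⟨$⟩ʳ y) ∙ m′
  f-translates m∈N with proj₁ f-normalises _ m∈N
  ... | m′ , _ , f[f⁻¹x∙m]≡x∙m′ = m′ , λ y →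
    trans (cong (λ z → f ⟨$⟩ʳ (z ∙ _)) (sym (f⁻¹∘f≗id f))) (f[f⁻¹x∙m]≡x∙m′ (f ⟨$⟩ʳ y))

  h-hom : ∀ y {m} → m ∈ N → h (y ∙ m) ≡ h y ∙ h m
  h-hom y {m} m∈N with f-translates m∈N
  ... | m′ , f[y∙m]≡fy∙m′ = begin
    (f ⟨$⟩ʳ (y ∙ m)) ∙ a ⁻¹                   ≡⟨ cong (_∙ a ⁻¹) (f[y∙m]≡fy∙m′ y) ⟩
    ((f ⟨$⟩ʳ y) ∙ m′) ∙ a ⁻¹                  ≡⟨ cong (λ z → ((f ⟨$⟩ʳ y) ∙ z) ∙ a ⁻¹) (\\-leftDividesʳ a m′) ⟨
    ((f ⟨$⟩ʳ y) ∙ (a ⁻¹ ∙ (a ∙ m′))) ∙ a ⁻¹    ≡⟨ cong (_∙ a ⁻¹) (assoc _ _ _) ⟨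
    (h y ∙ (a ∙ m′)) ∙ a ⁻¹                   ≡⟨ assoc _ _ _ ⟩
    h y ∙ ((a ∙ m′) ∙ a ⁻¹)                   ≡⟨ cong (λ z → h y ∙ (z ∙ a ⁻¹)) (f[y∙m]≡fy∙m′ e) ⟨
    h y ∙ ((f ⟨$⟩ʳ (e ∙ m)) ∙ a ⁻¹)           ≡⟨ cong (λ z → h y ∙ ((f ⟨$⟩ʳ z) ∙ a ⁻¹)) (identityˡ m) ⟩
    h y ∙ h m                                 ∎

  h-inv : ∀ {m} → m ∈ N → h (m ⁻¹) ≡ h m ⁻¹
  h-inv {m} m∈N = inverseˡ-unique (h (m ⁻¹)) (h m)
    (trans (sym (h-hom (m ⁻¹) m∈N)) (trans (cong h (inverseˡ m)) h-e))

  h≗id⇒InR : (∀ x → h x ≡ x) → InR R f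
  h≗id⇒InR h≗id = a , λ x → trans (sym (//-rightDividesˡ a (f ⟨$⟩ʳ x))) (cong (_∙ a) (h≗id x))

  fixed-factor : ∀ y {m} → m ∈ N → h m ≡ m → h (y ∙ m) ≡ y ∙ m → h y ≡ y
  fixed-factor y {m} m∈N hm≡m hym≡ym = ∙-cancelʳ m _ _ (begin
    h y ∙ m    ≡⟨ cong (h y ∙_) hm≡m ⟨
    h y ∙ h m  ≡⟨ h-hom y m∈N ⟨
    h (y ∙ m)  ≡⟨ hym≡ym ⟩
    y ∙ m      ∎)

  fixed-quotient : ∀ {y₁ y} → h y₁ ≡ y₁ → h y ≡ y → y₁ ⁻¹ ∙ y ∈ N → h (y₁ ⁻¹ ∙ y) ≡ y₁ ⁻¹ ∙ y
  fixed-quotient {y₁} {y} hy₁≡y₁ hy≡y m∈N = ∙-cancelˡ y₁ _ _ (begin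
    y₁ ∙ h (y₁ ⁻¹ ∙ y)    ≡⟨ cong (_∙ h (y₁ ⁻¹ ∙ y)) hy₁≡y₁ ⟨
    h y₁ ∙ h (y₁ ⁻¹ ∙ y)  ≡⟨ h-hom y₁ m∈N ⟨
    h (y₁ ∙ (y₁ ⁻¹ ∙ y))  ≡⟨ cong h (\\-leftDividesˡ y₁ y) ⟩
    h y                   ≡⟨ hy≡y ⟩
    y                     ≡⟨ \\-leftDividesˡ y₁ y ⟨
    y₁ ∙ (y₁ ⁻¹ ∙ y)      ∎)

-- Certificates

r^[1+i]*r²≤r^[2i+3] : ∀ r .{{_ : NonZero r}} i → r ^ suc i * (r * r) ≤ r ^ (2 * i + 3)
r^[1+i]*r²≤r^[2i+3] r i = begin
  r ^ suc i * (r * r)   ≡⟨ cong (λ s → r ^ suc i * (r * s)) (*-identityʳ r) ⟨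
  r ^ suc i * r ^ 2     ≡⟨ ^-distribˡ-+-* r (suc i) 2 ⟨
  r ^ (suc i + 2)       ≤⟨ ^-monoʳ-≤ r (≤-trans (m≤m+n (suc i + 2) i) (≤-reflexive (exponents i))) ⟩
  r ^ (2 * i + 3)       ∎
  where
  open ≤-Reasoning
  exponents : ∀ i → suc i + 2 + i ≡ 2 * i + 3
  exponents = solve-∀

[r*r]^[1+i]*r≡r^[2i+3] : ∀ r i → (r * r) ^ suc i * r ≡ r ^ (2 * i + 3)
[r*r]^[1+i]*r≡r^[2i+3] r i = begin
  (r * r) ^ suc i * r        ≡⟨ cong (λ s → (r * s) ^ suc i * r) (*-identityʳ r) ⟨
  (r ^ 2) ^ suc i * r        ≡⟨ cong₂ _*_ (^-*-assoc r 2 (suc i)) (sym (*-identityʳ r)) ⟩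
  r ^ (2 * suc i) * r ^ 1    ≡⟨ ^-distribˡ-+-* r (2 * suc i) 1 ⟨
  r ^ (2 * suc i + 1)        ≡⟨ cong (r ^_) (exponents i) ⟩
  r ^ (2 * i + 3)            ∎
  where
  open ≡-Reasoning
  exponents : ∀ i → 2 * suc i + 1 ≡ 2 * i + 3
  exponents = solve-∀

inject-fromℕ< : ∀ {r} {u v : Fin r} (u<v : toℕ u < toℕ v) → inject (fromℕ< u<v) ≡ u
inject-fromℕ< u<v = toℕ-injective (trans (toℕ-inject (fromℕ< u<v)) (toℕ-fromℕ< u<v))

module Certificates {r : ℕ} (R : FinGroup r) where
  open FinGroup R
  open Subgroups R

  module Pairs = Generation {Fin r × Fin r} (λ (x , x′) (y , y′) → x ∙ y , x′ ∙ y′) (e , e) (λ (x , x′) → x ⁻¹ , x′ ⁻¹)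
  open Pairs public using () renaming (⟨_⟩ to ⟨_⟩²)

  FirstOutside : List (Fin r) → Fin r → Set
  FirstOutside L x = ¬ ⟨ L ⟩ x × ((j : Fin′ x) → ⟨ L ⟩ (inject j))

  FirstOutside-unique : ∀ {L x y} → FirstOutside L x → FirstOutside L y → x ≡ y
  FirstOutside-unique {L} {x} {y} (x∉ , below-x) (y∉ , below-y) with <-cmp (toℕ x) (toℕ y)
  ... | tri< x<y _ _ = ⊥-elim (x∉ (subst ⟨ L ⟩ (inject-fromℕ< x<y) (below-y (fromℕ< x<y))))
  ... | tri≈ _ x≡y _ = toℕ-injective x≡y
  ... | tri> _ _ y<x = ⊥-elim (y∉ (subst ⟨ L ⟩ (inject-fromℕ< y<x) (below-x (fromℕ< y<x))))

  -- inj₁ (L , x , z) records the translation xk ↦ zk of the coset x⟨L⟩. inj₂ (P , z) records a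
  -- homomorphism k ↦ k′ on ⟨L⟩, L = map proj₁ P, by its values P on the generators, together with
  -- xk ↦ zk′ on the first coset x⟨L⟩ outside ⟨L⟩; that coset is determined by L, so x is not recorded.
  Certificate : Set
  Certificate = (List (Fin r) × Fin r × Fin r) ⊎ (List (Fin r × Fin r) × Fin r)

  Linked : Certificate → Fin r → Fin r → Set
  Linked (inj₁ (L , x , z)) u v = ∃ λ k → ⟨ L ⟩ k × u ≡ x ∙ k × v ≡ z ∙ k
  Linked (inj₂ (P , z)) u v = ∃₂ λ k k′ → ⟨ P ⟩² (k , k′) ×
    (u ≡ k × v ≡ k′ ⊎ ∃ λ x → FirstOutside (map proj₁ P) x × u ≡ x ∙ k × v ≡ z ∙ k′)

  Certified : ℕ → Certificate → Subset r → Set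
  Certified n c S = Closed (Linked c) S × Displacement n (Linked c)

  allPairs : List (Fin r × Fin r)
  allPairs = cartesianProduct (allFin r) (allFin r)

  certificates : ℕ → List Certificate
  certificates j =
    map inj₁ (cartesianProduct (tuples (allFin r) j) allPairs) ++
    map inj₂ (cartesianProduct (tuples allPairs j) (allFin r))

  ∈-certificates-coset : ∀ {L x z} → inj₁ (L , x , z) ∈ₗ certificates (length L)
  ∈-certificates-coset {L} {x} {z} = ∈-++⁺ˡ (∈-map⁺ inj₁ (∈-cartesianProduct⁺
    (∈-tuples (All.tabulate λ {y} _ → ∈-allFin y)) (∈-cartesianProduct⁺ (∈-allFin x) (∈-allFin z))))

  ∈-certificates-hom : ∀ {P z} → inj₂ (P , z) ∈ₗ certificates (length P)
  ∈-certificates-hom {P} {z} = ∈-++⁺ʳ _ (∈-map⁺ inj₂ (∈-cartesianProduct⁺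
    (∈-tuples (All.tabulate λ {(a , b)} _ → ∈-cartesianProduct⁺ (∈-allFin a) (∈-allFin b))) (∈-allFin z)))

  length-certificates : ∀ i → .{{NonZero r}} → length (certificates (suc i)) ≤ 2 * r ^ (2 * i + 3)
  length-certificates i = begin
    length (certificates (suc i))
      ≡⟨ length-++ (map inj₁ cosetData) ⟩
    length (map inj₁ cosetData) + length (map inj₂ homData)
      ≡⟨ cong₂ _+_ (length-map inj₁ cosetData) (length-map inj₂ homData) ⟩
    length cosetData + length homData
      ≡⟨ cong₂ _+_ (length-cartesianProductWith _,_ (tuples (allFin r) (suc i)) allPairs)
                   (length-cartesianProductWith _,_ (tuples allPairs (suc i)) (allFin r)) ⟩
    length (tuples (allFin r) (suc i)) * length allPairs + length (tuples allPairs (suc i)) * length (allFin r)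
      ≡⟨ cong₂ _+_ (cong₂ _*_ (trans (length-tuples (allFin r) (suc i)) (cong (_^ suc i) |allFin|)) |allPairs|)
                   (cong₂ _*_ (trans (length-tuples allPairs (suc i)) (cong (_^ suc i) |allPairs|)) |allFin|) ⟩
    r ^ suc i * (r * r) + (r * r) ^ suc i * r
      ≤⟨ +-mono-≤ (r^[1+i]*r²≤r^[2i+3] r i) (≤-reflexive ([r*r]^[1+i]*r≡r^[2i+3] r i)) ⟩
    r ^ (2 * i + 3) + r ^ (2 * i + 3)
      ≡⟨ cong (r ^ (2 * i + 3) +_) (+-identityʳ _) ⟨
    2 * r ^ (2 * i + 3) ∎
    where
    open ≤-Reasoning
    cosetData = cartesianProduct (tuples (allFin r) (suc i)) allPairs
    homData = cartesianProduct (tuples allPairs (suc i)) (allFin r)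
    |allFin| : length (allFin r) ≡ r
    |allFin| = length-tabulate id
    |allPairs| : length allPairs ≡ r * r
    |allPairs| = trans (length-cartesianProductWith _,_ (allFin r) (allFin r)) (cong₂ _*_ |allFin| |allFin|)

more-moved-than-fixed : ∀ {k f₁ f₂ a} → k + k ≡ (f₁ + f₂) + a → 2 * f₁ ≤ k → f₂ ≤ f₁ → k ≤ a
more-moved-than-fixed {k} {f₁} {f₂} {a} split f₁-half f₂≤f₁ = +-cancelˡ-≤ k k a (begin
  k + k            ≡⟨ split ⟩
  (f₁ + f₂) + a    ≤⟨ +-monoˡ-≤ a (+-monoʳ-≤ f₁ f₂≤f₁) ⟩
  (f₁ + f₁) + a    ≡⟨ cong (λ f → (f₁ + f) + a) (sym (+-identityʳ f₁)) ⟩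
  2 * f₁ + a       ≤⟨ +-monoˡ-≤ a f₁-half ⟩
  k + a            ∎)
  where open ≤-Reasoning

module Certification {r : ℕ} (R : FinGroup r) {S N : Subset r} {f}
    (f-aut : IsAut R S f) (f-normalises : Normalises R f N) (N-subgroup : IsSubgroup R N) where
  open FinGroup R
  open GroupProperties (asGroup R) using (∙-cancelˡ; ∙-cancelʳ)
  open Subgroups R
  open Certificates R
  open Twist R {S} {N} {f} f-aut f-normalises

  e∈N : e ∈ N
  e∈N = proj₁ N-subgroup
  ∙∈N : ∀ x y → x ∈ N → y ∈ N → x ∙ y ∈ N
  ∙∈N = proj₁ (proj₂ N-subgroup)
  ⁻¹∈N : ∀ x → x ∈ N → x ⁻¹ ∈ N
  ⁻¹∈N = proj₂ (proj₂ N-subgroup)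

  closed-along-h : ∀ {c} → (∀ {u v} → Linked c u v → h u ≡ v) → Closed (Linked c) S
  closed-along-h linked⇒h {u} u~v = subst (λ v → u ∈ S ⇔ v ∈ S) (linked⇒h u~v) (∈⇔h∈ u)

  module _ {n i m} (n≤2^[1+i] : n ≤ 2 ^ suc i) (n≤∣N∣ : n ≤ ∣ N ∣) (s : LargeSpan N-subgroup i m) where
    open LargeSpan s

    K : List (Fin r)
    K = elementsOf ⟨gens⟩?

    K! : Unique K
    K! = elementsOf-unique ⟨gens⟩?

    K⊆N : ∀ {k} → k ∈ₗ K → k ∈ N
    K⊆N = ⟨⟩-least N-subgroup gens⊆N ∘ ∈-elementsOf⁻ ⟨gens⟩?

    K-large : n ≤ length K
    K-large = LargeSpan-size N-subgroup n≤2^[1+i] n≤∣N∣ s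

    coset-certified : (∀ {m} → m ∈ N → h m ≡ m) → ∀ {x₀} → h x₀ ≢ x₀ → Certified n (inj₁ (gens , x₀ , h x₀)) S
    coset-certified h-fixes-N {x₀} hx₀≢x₀ =
      closed-along-h {inj₁ (gens , x₀ , h x₀)} (λ { (k , k∈ , refl , refl) → h[x₀k] (generated⊆N k∈) }) , record
      { shift = h ; shift-injective = h-injective
      ; support = map (x₀ ∙_) K
      ; support-unique = map⁺ (∙-cancelˡ x₀ _ _) K!
      ; support-large = subst (n ≤_) (sym (length-map (x₀ ∙_) K)) K-large
      ; shift-moves = All.map⁺ (All.tabulate λ k∈ hx₀k≡x₀k →
          hx₀≢x₀ (∙-cancelʳ _ _ _ (trans (sym (h[x₀k] (K⊆N k∈))) hx₀k≡x₀k)))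
      ; shift-along = All.map⁺ (All.tabulate λ {k} k∈ → k , ∈-elementsOf⁻ ⟨gens⟩? k∈ , refl , h[x₀k] (K⊆N k∈)) }
      where
      generated⊆N : ∀ {k} → ⟨ gens ⟩ k → k ∈ N
      generated⊆N = ⟨⟩-least N-subgroup gens⊆N
      h[x₀k] : ∀ {k} → k ∈ N → h (x₀ ∙ k) ≡ h x₀ ∙ k
      h[x₀k] k∈N = trans (h-hom x₀ k∈N) (cong (h x₀ ∙_) (h-fixes-N k∈N))

    graph : List (Fin r × Fin r)
    graph = map (λ l → l , h l) gens

    ⟨graph⟩⇒h : ∀ {k k′} → ⟨ graph ⟩² (k , k′) → k ∈ N × h k ≡ k′
    ⟨graph⟩⇒h = Pairs.⟨⟩-least {Q = λ (k , k′) → k ∈ N × h k ≡ k′}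
      ( (e∈N , h-e)
      , (λ { _ (y , _) (x∈N , refl) (y∈N , refl) → ∙∈N _ _ x∈N y∈N , h-hom _ y∈N })
      , (λ { _ (x∈N , refl) → ⁻¹∈N _ x∈N , h-inv x∈N }))
      (All.map⁺ (All.map (λ l∈N → l∈N , refl) gens⊆N))

    ⟨gens⟩⇒⟨graph⟩ : ∀ {k} → ⟨ gens ⟩ k → ⟨ graph ⟩² (k , h k)
    ⟨gens⟩⇒⟨graph⟩ = proj₂ ∘ ⟨⟩-least {Q = λ k → k ∈ N × ⟨ graph ⟩² (k , h k)}
      ( (e∈N , subst (λ z → ⟨ graph ⟩² (e , z)) (sym h-e) Pairs.ε∈)
      , (λ x y (x∈N , ⟨x⟩) (y∈N , ⟨y⟩) →
           ∙∈N x y x∈N y∈N , subst (λ z → ⟨ graph ⟩² (x ∙ y , z)) (sym (h-hom x y∈N)) (Pairs.∙∈ ⟨x⟩ ⟨y⟩))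
      , (λ x (x∈N , ⟨x⟩) → ⁻¹∈N x x∈N , subst (λ z → ⟨ graph ⟩² (x ⁻¹ , z)) (sym (h-inv x∈N)) (Pairs.⁻¹∈ ⟨x⟩)))
      (All.tabulate λ l∈ → All.lookup gens⊆N l∈ , Pairs.generator (∈-map⁺ _ l∈))

    fixed? : Decidable (λ y → h y ≡ y)
    fixed? y = h y ≟ y

    fixed-at-most-half : h m ≢ m → 2 * length (filter fixed? K) ≤ length K
    fixed-at-most-half hm≢m = coset-doubling m (filter⁺ fixed? K!) (proj₁ ∘ ∈-filter⁻ fixed? {xs = K})
      (λ k∈ → ∈-elementsOf⁺ ⟨gens⟩? (∙∈ m∈span (∈-elementsOf⁻ ⟨gens⟩? (proj₁ (∈-filter⁻ fixed? {xs = K} k∈)))))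
      (λ k∈ mk∈ → let (k∈K , hk≡k) = ∈-filter⁻ fixed? {xs = K} k∈ in
        hm≢m (fixed-factor m (K⊆N k∈K) hk≡k (proj₂ (∈-filter⁻ fixed? {xs = K} mk∈))))

    fixed-in-coset : ∀ x → length (filter fixed? (map (x ∙_) K)) ≤ length (filter fixed? K)
    fixed-in-coset x = translate (filter⁺ fixed? (map⁺ (∙-cancelˡ x _ _) K!)) (All.tabulate (∈-filter⁻ fixed?))
      where
      translate : ∀ {F} → Unique F → All (λ y → y ∈ₗ map (x ∙_) K × h y ≡ y) F → length F ≤ length (filter fixed? K)
      translate {[]} _ _ = z≤n
      translate {y₁ ∷ _} F! all@((y₁∈ , hy₁≡y₁) ∷ _) =
        injection⇒length≤ (λ {a} {b} → ∙-cancelˡ (y₁ ⁻¹) a b) F! λ y∈ → let (y∈ , hy≡y) = All.lookup all y∈ in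
          ∈-filter⁺ fixed? (∈-elementsOf⁺ ⟨gens⟩? (quotient∈ y₁∈ y∈)) (fixed-quotient hy₁≡y₁ hy≡y (quotient∈N y₁∈ y∈))
        where
        quotient∈ : ∀ {y₁ y} → y₁ ∈ₗ map (x ∙_) K → y ∈ₗ map (x ∙_) K → ⟨ gens ⟩ (y₁ ⁻¹ ∙ y)
        quotient∈ y₁∈ y∈ with ∈-map⁻ (x ∙_) y₁∈ | ∈-map⁻ (x ∙_) y∈
        ... | k₁ , k₁∈ , refl | k , k∈ , refl = subst ⟨ gens ⟩ (sym (coset-quotient x k₁ k))
          (∙∈ (⁻¹∈ (∈-elementsOf⁻ ⟨gens⟩? k₁∈)) (∈-elementsOf⁻ ⟨gens⟩? k∈))
        quotient∈N : ∀ {y₁ y} → y₁ ∈ₗ map (x ∙_) K → y ∈ₗ map (x ∙_) K → y₁ ⁻¹ ∙ y ∈ N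
        quotient∈N y₁∈ y∈ = ⟨⟩-least N-subgroup gens⊆N (quotient∈ y₁∈ y∈)

    moved? : Decidable (λ y → h y ≢ y)
    moved? = ∁? fixed?

    K∪xK : Fin r → List (Fin r)
    K∪xK x = K ++ map (x ∙_) K

    K∪xK-unique : ∀ {x} → ¬ ⟨ gens ⟩ x → Unique (K∪xK x)
    K∪xK-unique {x} x∉span = ++⁺ K! (map⁺ (∙-cancelˡ x _ _) K!) λ (v∈K , v∈xK) → x∉K v∈K (∈-map⁻ (x ∙_) v∈xK)
      where
      x∉K : ∀ {v} → v ∈ₗ K → ¬ ∃ (λ k → k ∈ₗ K × v ≡ x ∙ k)
      x∉K v∈K (k , k∈K , refl) = x∉span (⟨⟩-divide (∈-elementsOf⁻ ⟨gens⟩? k∈K) (∈-elementsOf⁻ ⟨gens⟩? v∈K))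

    -- The points of K fixed by h form a proper subgroup of K, as m is moved, and those of xK at most
    -- one coset of it; so at least |K| of the 2|K| points of K ∪ xK are moved.
    moved-large : h m ≢ m → ∀ x → length K ≤ length (filter moved? (K∪xK x))
    moved-large hm≢m x = more-moved-than-fixed (begin
      length K + length K                                        ≡⟨ cong (length K +_) (length-map (x ∙_) K) ⟨
      length K + length (map (x ∙_) K)                           ≡⟨ length-++ K ⟨
      length (K∪xK x)                                            ≡⟨ length-filter-∁ fixed? (K∪xK x) ⟩
      length (filter fixed? (K∪xK x)) + length (filter moved? (K∪xK x))
        ≡⟨ cong (λ F → length F + length (filter moved? (K∪xK x))) (filter-++ fixed? K (map (x ∙_) K)) ⟩
      length (filter fixed? K ++ filter fixed? (map (x ∙_) K)) + length (filter moved? (K∪xK x))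
        ≡⟨ cong (_+ length (filter moved? (K∪xK x))) (length-++ (filter fixed? K)) ⟩
      length (filter fixed? K) + length (filter fixed? (map (x ∙_) K)) + length (filter moved? (K∪xK x)) ∎)
      (fixed-at-most-half hm≢m) (fixed-in-coset x)
      where open ≡-Reasoning

    graph-domain : map proj₁ graph ≡ gens
    graph-domain = trans (sym (map-∘ gens)) (map-id gens)

    hom-certified : h m ≢ m → ∀ {x₀} → FirstOutside gens x₀ → Certified n (inj₂ (graph , h x₀)) S
    hom-certified hm≢m {x₀} x₀-first@(x₀∉span , _) = closed-along-h {inj₂ (graph , h x₀)} linked⇒h , record
      { shift = h ; shift-injective = h-injective
      ; support = filter moved? (K∪xK x₀)
      ; support-unique = filter⁺ moved? (K∪xK-unique x₀∉span)
      ; support-large = ≤-trans K-large (moved-large hm≢m x₀)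
      ; shift-moves = All.all-filter moved? (K∪xK x₀)
      ; shift-along = All.filter⁺ moved? (All.++⁺
          (All.tabulate λ {k} k∈ → k , h k , ⟨gens⟩⇒⟨graph⟩ (∈-elementsOf⁻ ⟨gens⟩? k∈) , inj₁ (refl , refl))
          (All.map⁺ (All.tabulate λ {k} k∈ →
            k , h k , ⟨gens⟩⇒⟨graph⟩ (∈-elementsOf⁻ ⟨gens⟩? k∈) , inj₂ (x₀ , x₀-first′ , refl , h-hom x₀ (K⊆N k∈))))) }
      where
      x₀-first′ : FirstOutside (map proj₁ graph) x₀
      x₀-first′ = subst (λ L → FirstOutside L x₀) (sym graph-domain) x₀-first

      linked⇒h : ∀ {u v} → Linked (inj₂ (graph , h x₀)) u v → h u ≡ v
      linked⇒h (_ , _ , kk′∈ , inj₁ (refl , refl)) = proj₂ (⟨graph⟩⇒h kk′∈)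
      linked⇒h (_ , _ , kk′∈ , inj₂ (x , x-first , refl , refl))
        with FirstOutside-unique x-first x₀-first′ | ⟨graph⟩⇒h kk′∈
      ... | refl | k∈N , refl = h-hom x₀ k∈N

  certify : ∀ {n i} → n ≤ 2 ^ suc i → n ≤ ∣ N ∣ → NonIdentity R N → Proper R N → ¬ InR R f →
    ¬ ¬ (∃ λ c → c ∈ₗ certificates (suc i) × Certified n c S)
  certify {n} {i} n≤2^[1+i] n≤∣N∣ (m₀ , m₀∈N , m₀≢e) (y₀ , y₀∉N) f∉R
    with Fin.any? (λ m → m ∈? N ×-dec ¬? (h m ≟ m))
  ... | yes (m₁ , m₁∈N , hm₁≢m₁) = do
    s ← large-span N-subgroup m₁∈N (λ { refl → hm₁≢m₁ h-e }) i
    let open LargeSpan s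
        (x₀ , x₀-first) = ¬∀⟶∃¬-smallest r ⟨ gens ⟩ ⟨gens⟩? λ all → y₀∉N (⟨⟩-least N-subgroup gens⊆N (all y₀))
        P = graph n≤2^[1+i] n≤∣N∣ s
    pure ( inj₂ (P , h x₀)
         , subst (λ j → inj₂ (P , h x₀) ∈ₗ certificates j) (trans (length-map _ gens) gens-length) ∈-certificates-hom
         , hom-certified n≤2^[1+i] n≤∣N∣ s hm₁≢m₁ x₀-first )
  ... | no N-fixed = do
    s ← large-span N-subgroup m₀∈N m₀≢e i
    let open LargeSpan s
        (x₀ , hx₀≢x₀) = ¬∀⟶∃¬ r (λ x → h x ≡ x) (λ x → h x ≟ x) (f∉R ∘ h≗id⇒InR)
    pure ( inj₁ (gens , x₀ , h x₀)
         , subst (λ j → inj₁ (gens , x₀ , h x₀) ∈ₗ certificates j) gens-length ∈-certificates-coset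
         , coset-certified n≤2^[1+i] n≤∣N∣ s h-fixes-N hx₀≢x₀ )
    where
    h-fixes-N : ∀ {m} → m ∈ N → h m ≡ m
    h-fixes-N {m} m∈N = decidable-stable (h m ≟ m) λ hm≢m → N-fixed (m , m∈N , hm≢m)

log₂-bracket : ∀ n → .{{NonZero n}} → ∃ λ i → 2 ^ i ≤ n × n < 2 ^ suc i
log₂-bracket 1 = 0 , ≤-refl , ≤-refl
log₂-bracket (suc (suc n)) with log₂-bracket (suc n)
... | i , 2^i≤1+n , 1+n<2^[1+i] with m≤n⇒m<n∨m≡n 1+n<2^[1+i]
...   | inj₁ 2+n<2^[1+i] = i , m≤n⇒m≤1+n 2^i≤1+n , 2+n<2^[1+i]
...   | inj₂ 2+n≡2^[1+i] = suc i , ≤-reflexive (sym 2+n≡2^[1+i]) ,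
  subst (λ m → m < 2 ^ suc (suc i)) (sym 2+n≡2^[1+i])
    (subst (2 ^ suc i <_) (cong (2 ^ suc i +_) (sym (+-identityʳ (2 ^ suc i)))) (m<m+n (2 ^ suc i) (m^n>0 2 (suc i))))

r-minus-half-n : ∀ {n r} → n ≤ r → ∃ λ b → 2 * r ≤ 2 * b + n × 2 * b + n ≤ 2 * r + 1
r-minus-half-n {n} {r} n≤r =
  r ∸ n / 2 , ≤-trans (m≤m+n (2 * r) (n % 2)) (≤-reflexive (sym split)) ,
  ≤-trans (≤-reflexive split) (+-monoʳ-≤ (2 * r) (≤-pred (m%n<n n 2)))
  where
  rearrange : ∀ a m k → 2 * a + (m + k * 2) ≡ 2 * (a + k) + m
  rearrange = solve-∀
  split : 2 * (r ∸ n / 2) + n ≡ 2 * r + n % 2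
  split = begin
    2 * (r ∸ n / 2) + n                     ≡⟨ cong (2 * (r ∸ n / 2) +_) (m≡m%n+[m/n]*n n 2) ⟩
    2 * (r ∸ n / 2) + (n % 2 + n / 2 * 2)   ≡⟨ rearrange (r ∸ n / 2) (n % 2) (n / 2) ⟩
    2 * (r ∸ n / 2 + n / 2) + n % 2         ≡⟨ cong (λ a → 2 * a + n % 2) (m∸n+n≡m (≤-trans (m/n≤m n 2) n≤r)) ⟩
    2 * r + n % 2                           ∎
    where open ≡-Reasoning

8i+10≤n : ∀ {i n} → 71 ≤ n → 2 ^ i ≤ n → 8 * i + 10 ≤ n
8i+10≤n {i} {n} 71≤n 2^i≤n with 7 ≤? i
... | yes 7≤i = ≤-trans (subst (λ j → 8 * j + 10 ≤ 2 ^ j) (m+[n∸m]≡n 7≤i) (linear≤exponential (i ∸ 7))) 2^i≤n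
  where
  linear≤exponential : ∀ k → 8 * (7 + k) + 10 ≤ 2 ^ (7 + k)
  linear≤exponential zero = m≤m+n 66 62
  linear≤exponential (suc k) = begin
    8 * (7 + suc k) + 10           ≡⟨ step k ⟩
    (8 * (7 + k) + 10) + 8         ≤⟨ +-mono-≤ (linear≤exponential k) (^-monoʳ-≤ 2 {3} {7 + k} (m≤m+n 3 (4 + k))) ⟩
    2 ^ (7 + k) + 2 ^ (7 + k)      ≡⟨ cong (2 ^ (7 + k) +_) (sym (+-identityʳ (2 ^ (7 + k)))) ⟩
    2 ^ (7 + suc k)                ∎
    where
    open ≤-Reasoning
    step : ∀ k → 8 * (7 + suc k) + 10 ≡ (8 * (7 + k) + 10) + 8
    step = solve-∀
... | no i≱7 = ≤-trans (+-monoˡ-≤ 10 (*-monoʳ-≤ 8 (≤-pred (≰⇒> i≱7)))) (≤-trans (m≤m+n 58 13) 71≤n)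

iq≤p : ∀ {i n p q} → 2 ^ i ≤ n → n ^ q < 2 ^ p → i * q ≤ p
iq≤p {i} {n} {p} {q} 2^i≤n n^q<2^p with i * q ≤? p
... | yes iq≤p = iq≤p
... | no iq≰p = contradiction (≤-<-trans 2^[1+p]≤n^q n^q<2^p) (≤⇒≯ (^-monoʳ-≤ 2 (n≤1+n p)))
  where
  2^[1+p]≤n^q : 2 ^ suc p ≤ n ^ q
  2^[1+p]≤n^q = begin
    2 ^ suc p    ≤⟨ ^-monoʳ-≤ 2 (≰⇒> iq≰p) ⟩
    2 ^ (i * q)  ≡⟨ ^-*-assoc 2 i q ⟨
    (2 ^ i) ^ q  ≤⟨ ^-monoˡ-≤ q 2^i≤n ⟩
    n ^ q        ∎
    where open ≤-Reasoning

2xy≤x²+y²-ordered : ∀ {x y} → x ≤ y → 2 * x * y ≤ x * x + y * y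
2xy≤x²+y²-ordered {x} {y} x≤y = subst (λ y → 2 * x * y ≤ x * x + y * y) (m+[n∸m]≡n x≤y)
  (subst (2 * x * (x + (y ∸ x)) ≤_) (square-gap x (y ∸ x)) (m≤m+n _ _))
  where
  square-gap : ∀ x d → 2 * x * (x + d) + d * d ≡ x * x + (x + d) * (x + d)
  square-gap = solve-∀

2xy≤x²+y² : ∀ x y → 2 * x * y ≤ x * x + y * y
2xy≤x²+y² x y with ≤-total x y
... | inj₁ x≤y = 2xy≤x²+y²-ordered x≤y
... | inj₂ y≤x = subst₂ _≤_ (swap y x) (+-comm (y * y) (x * x)) (2xy≤x²+y²-ordered y≤x)
  where
  swap : ∀ y x → 2 * y * x ≡ 2 * x * y
  swap = solve-∀

^-distribʳ-* : ∀ x y k → (x * y) ^ k ≡ x ^ k * y ^ k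
^-distribʳ-* x y zero = refl
^-distribʳ-* x y (suc k) = trans (cong (x * y *_) (^-distribʳ-* x y k)) (interchange x y (x ^ k) (y ^ k))
  where
  interchange : ∀ a b c d → a * b * (c * d) ≡ a * c * (b * d)
  interchange = solve-∀

quadratic-slack : ∀ {r n i b} → 8 * i + 10 ≤ n → 2 * b + n ≤ 2 * r + 1 →
  4 + 4 * suc i * suc i + 4 * b + n ≤ 4 * r + 4 * i * i
quadratic-slack {r} {n} {i} {b} 8i+10≤n b-small = +-cancelʳ-≤ n _ _ (begin
  4 + 4 * suc i * suc i + 4 * b + n + n     ≡⟨ double-b i b n ⟩
  4 + 4 * suc i * suc i + 2 * (2 * b + n)   ≤⟨ +-monoʳ-≤ (4 + 4 * suc i * suc i) (*-monoʳ-≤ 2 b-small) ⟩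
  4 + 4 * suc i * suc i + 2 * (2 * r + 1)   ≡⟨ expand i r ⟩
  4 * r + 4 * i * i + (8 * i + 10)          ≤⟨ +-monoʳ-≤ (4 * r + 4 * i * i) 8i+10≤n ⟩
  4 * r + 4 * i * i + n                     ∎)
  where
  open ≤-Reasoning
  double-b : ∀ i b n → 4 + 4 * suc i * suc i + 4 * b + n + n ≡ 4 + 4 * suc i * suc i + 2 * (2 * b + n)
  double-b = solve-∀
  expand : ∀ i r → 4 + 4 * suc i * suc i + 2 * (2 * r + 1) ≡ 4 * r + 4 * i * i + (8 * i + 10)
  expand = solve-∀

-- The cross term s (2i + 2) 4q²t is 2xy for x = 2(i + 1)qt and y = 2sq, so AM-GM absorbs it.
exponent-bound : ∀ {r n i b p q s t} → 8 * i + 10 ≤ n → 2 * b + n ≤ 2 * r + 1 → i * q ≤ p →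
  suc b * (4 * q * q * t * t) + s * ((2 * i + 3) * (4 * q * q * t)) + n * q * q * t * t
    ≤ 4 * q * q * t * t * r + 4 * p * p * t * t + 4 * s * s * q * q + 4 * s * t * q * q
exponent-bound {r} {n} {i} {b} {p} {q} {s} {t} 8i+10≤n b-small iq≤p = begin
  suc b * (4 * q * q * t * t) + s * ((2 * i + 3) * (4 * q * q * t)) + n * q * q * t * t
    ≡⟨ regroup q t s i b n ⟩
  base + 2 * X * Y
    ≤⟨ +-monoʳ-≤ base (2xy≤x²+y² X Y) ⟩
  base + (X * X + Y * Y)
    ≡⟨ complete-square q t s i b n ⟩
  q * q * t * t * (4 + 4 * suc i * suc i + 4 * b + n) + 4 * s * s * q * q + 4 * s * t * q * q
    ≤⟨ +-monoˡ-≤ (4 * s * t * q * q) (+-monoˡ-≤ (4 * s * s * q * q)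
         (*-monoʳ-≤ (q * q * t * t) (quadratic-slack {r} {n} {i} {b} 8i+10≤n b-small))) ⟩
  q * q * t * t * (4 * r + 4 * i * i) + 4 * s * s * q * q + 4 * s * t * q * q
    ≡⟨ expand q t s i r ⟩
  4 * q * q * t * t * r + 4 * (i * q) * (i * q) * t * t + 4 * s * s * q * q + 4 * s * t * q * q
    ≤⟨ +-monoˡ-≤ (4 * s * t * q * q) (+-monoˡ-≤ (4 * s * s * q * q) (+-monoʳ-≤ (4 * q * q * t * t * r)
         (*-monoˡ-≤ t (*-monoˡ-≤ t (*-mono-≤ (*-monoʳ-≤ 4 iq≤p) iq≤p))))) ⟩
  4 * q * q * t * t * r + 4 * p * p * t * t + 4 * s * s * q * q + 4 * s * t * q * q ∎
  where
  open ≤-Reasoning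
  X = 2 * suc i * q * t
  Y = 2 * s * q
  base = q * q * t * t * (4 + 4 * b + n) + 4 * s * t * q * q
  regroup : ∀ q t s i b n →
    suc b * (4 * q * q * t * t) + s * ((2 * i + 3) * (4 * q * q * t)) + n * q * q * t * t
      ≡ (q * q * t * t * (4 + 4 * b + n) + 4 * s * t * q * q) + 2 * (2 * suc i * q * t) * (2 * s * q)
  regroup = solve-∀
  complete-square : ∀ q t s i b n →
    (q * q * t * t * (4 + 4 * b + n) + 4 * s * t * q * q)
        + ((2 * suc i * q * t) * (2 * suc i * q * t) + (2 * s * q) * (2 * s * q))
      ≡ q * q * t * t * (4 + 4 * suc i * suc i + 4 * b + n) + 4 * s * s * q * q + 4 * s * t * q * q
  complete-square = solve-∀
  expand : ∀ q t s i r →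
    q * q * t * t * (4 * r + 4 * i * i) + 4 * s * s * q * q + 4 * s * t * q * q
      ≡ 4 * q * q * t * t * r + 4 * (i * q) * (i * q) * t * t + 4 * s * s * q * q + 4 * s * t * q * q
  expand = solve-∀

Log2Bound-zero : ∀ r n → Log2Bound 0 r n
Log2Bound-zero r n p (suc q) s (suc t) _ _ _ _ = z≤n

Log2Bound-intro : ∀ {c r n i b} → 71 ≤ n → 2 ^ i ≤ n → 2 * b + n ≤ 2 * r + 1 →
  c ≤ 2 * r ^ (2 * i + 3) * 2 ^ b → Log2Bound c r n
Log2Bound-intro {c} {r} {n} {i} {b} 71≤n 2^i≤n b-small c≤ p q s t _ _ n^q<2^p r^t<2^s = begin
  c ^ M * 2 ^ W
    ≤⟨ *-monoˡ-≤ (2 ^ W) (^-monoˡ-≤ M (≤-trans c≤ (≤-reflexive (swap (r ^ j) (2 ^ b))))) ⟩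
  (2 ^ suc b * r ^ j) ^ M * 2 ^ W
    ≡⟨ cong (_* 2 ^ W) (^-distribʳ-* (2 ^ suc b) (r ^ j) M) ⟩
  (2 ^ suc b) ^ M * (r ^ j) ^ M * 2 ^ W
    ≡⟨ cong (λ z → (2 ^ suc b) ^ M * z * 2 ^ W) r-power ⟩
  (2 ^ suc b) ^ M * (r ^ t) ^ (j * T) * 2 ^ W
    ≤⟨ *-monoˡ-≤ (2 ^ W) (*-monoʳ-≤ ((2 ^ suc b) ^ M) (^-monoˡ-≤ (j * T) (<⇒≤ r^t<2^s))) ⟩
  (2 ^ suc b) ^ M * (2 ^ s) ^ (j * T) * 2 ^ W
    ≡⟨ collect ⟩
  2 ^ (suc b * M + s * (j * T) + W)
    ≤⟨ ^-monoʳ-≤ 2 (exponent-bound {r} {n} {i} {b} {p} {q} {s} {t}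
                     (8i+10≤n {i} 71≤n 2^i≤n) b-small (iq≤p {i} {n} {p} {q} 2^i≤n n^q<2^p)) ⟩
  2 ^ (4 * q * q * t * t * r + 4 * p * p * t * t + 4 * s * s * q * q + 4 * s * t * q * q) ∎
  where
  open ≤-Reasoning
  M = 4 * q * q * t * t
  T = 4 * q * q * t
  W = n * q * q * t * t
  j = 2 * i + 3
  swap : ∀ x y → 2 * x * y ≡ 2 * y * x
  swap = solve-∀
  exponent-split : ∀ j q t → j * (4 * q * q * t * t) ≡ t * (j * (4 * q * q * t))
  exponent-split = solve-∀
  r-power : (r ^ j) ^ M ≡ (r ^ t) ^ (j * T)
  r-power = trans (^-*-assoc r j M) (trans (cong (r ^_) (exponent-split j q t)) (sym (^-*-assoc r t (j * T))))
  collect : (2 ^ suc b) ^ M * (2 ^ s) ^ (j * T) * 2 ^ W ≡ 2 ^ (suc b * M + s * (j * T) + W)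
  collect = sym (begin-equality
    2 ^ (suc b * M + s * (j * T) + W)               ≡⟨ ^-distribˡ-+-* 2 (suc b * M + s * (j * T)) W ⟩
    2 ^ (suc b * M + s * (j * T)) * 2 ^ W           ≡⟨ cong (_* 2 ^ W) (^-distribˡ-+-* 2 (suc b * M) (s * (j * T))) ⟩
    2 ^ (suc b * M) * 2 ^ (s * (j * T)) * 2 ^ W
      ≡⟨ cong₂ (λ u v → u * v * 2 ^ W) (^-*-assoc 2 (suc b) M) (^-*-assoc 2 s (j * T)) ⟨
    (2 ^ suc b) ^ M * (2 ^ s) ^ (j * T) * 2 ^ W     ∎)

bad⇒certified : ∀ {r} (R : FinGroup r) {n i S} → n ≤ 2 ^ suc i → Bad R n S →
  ¬ ¬ (∃ λ c → c ∈ₗ Certificates.certificates R (suc i) × Certificates.Certified R n c S)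
bad⇒certified R {n} {i} {S} n≤2^[1+i]
  (N , f , (N-subgroup , _) , nontrivial , proper , n≤∣N∣ , f-aut , f-normalises , f∉R , _) =
  Certification.certify R {S} {N} {f} f-aut f-normalises N-subgroup {n} {i}
    n≤2^[1+i] n≤∣N∣ nontrivial proper f∉R

-- Membership in a generated subgroup is decidable only classically; the double negation is
-- discharged because the bound is a decidable inequality.
count-bad : ∀ {r} (R : FinGroup r) {n i} b → n ≤ 2 ^ suc i → 2 * r ≤ 2 * b + n →
  CountBound (Bad R n) (_≤ length (Certificates.certificates R (suc i)) * 2 ^ b)
count-bad R {n} {i} b n≤2^[1+i] budget Ss Ss! bad =
  decidable-stable (length Ss ≤? length (certificates (suc i)) * 2 ^ b) do
    certified ← All.mapM 0ℓ ¬¬-Monad (bad⇒certified R {n} {i} n≤2^[1+i]) bad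
    pure (union-bound (Certified n) (λ _ → count-closed b budget) (certificates (suc i)) Ss Ss! certified)
  where open Certificates R

theorem2p4 : (r : ℕ) (R : FinGroup r) (n : ℕ) → 71 ≤ n →
    CountBound (Bad R n) (λ c → Log2Bound c r n)
theorem2p4 r R n 71≤n [] _ _ = Log2Bound-zero r n
theorem2p4 r R n 71≤n Ss@(_ ∷ _) Ss! bad@((N , _ , _ , _ , _ , n≤∣N∣ , _) ∷ _)
  with log₂-bracket n {{>-nonZero (≤-trans (s≤s z≤n) 71≤n)}} | r-minus-half-n (≤-trans n≤∣N∣ (∣p∣≤n N))
... | i , 2^i≤n , n<2^[1+i] | b , budget , b-small =
  Log2Bound-intro {length Ss} {r} {n} {i} {b} 71≤n 2^i≤n b-small (begin
    length Ss                              ≤⟨ count-bad R {n} {i} b (<⇒≤ n<2^[1+i]) budget Ss Ss! bad ⟩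
    length (certificates (suc i)) * 2 ^ b  ≤⟨ *-monoˡ-≤ (2 ^ b) (length-certificates i {{nonZeroIndex e}}) ⟩
    2 * r ^ (2 * i + 3) * 2 ^ b            ∎)
  where
  open ≤-Reasoning
  open FinGroup R using (e)
  open Certificates R
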